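{- Let $m,r\ge 1$ be integers with $m\ge\binom{2r-1}{r}$, and let the $r$-expansion of $m$ be $m=\binom{a_{r_1}}{r_1}+\dots+\binom{a_{r_s}}{r_s}$. Then: (1) $r=r_1>r_2>\dots>r_s\ge 1$; (2) $a_{r_1}>a_{r_2}>\dots>a_{r_s}\ge 1$; (3) $r_i\le\lceil a_{r_i}/2\rceil$ for all $i\in[s]$.
   Context: For integers $m,r\ge1$ with $m\ge\binom{2r-1}{r}$, the $r$-expansion of $m$ is defined recursively: set $r_1=r$ and let $a_{r_1}$ be the largest integer $j$ with $\binom{j}{r_1}\le m$; put $m'=m-\binom{a_{r_1}}{r_1}$. If $m'=0$ the expansion is $m=\binom{a_{r_1}}{r_1}$. Otherwise let $r'$ be the largest integer $j\le r-1$ with $\binom{2j-1}{j}\le m'$, and the $r$-expansion of $m$ is $\binom{a_{r_1}}{r_1}$ followed by the terms of the $r'$-expansion of $m'$. The terms are written $\binom{a_{r_1}}{r_1}+\dots+\binom{a_{r_s}}{r_s}$. -}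

module Defs where

open import Data.Nat using (ℕ; _*_; _∸_; _≤_)
open import Data.Nat.Combinatorics using (_C_)
open import Data.Product using (_×_; _,_)
open import Data.List using (List; []; _∷_)
open import Relation.Binary.PropositionalEquality using (_≡_)
open import Relation.Nullary using (¬_)

IsLargestA : ℕ → ℕ → ℕ → Set
IsLargestA r m a = (a C r ≤ m) × (∀ j → j C r ≤ m → j ≤ a)

IsLargestR : ℕ → ℕ → ℕ → Set
IsLargestR r m' r' =
  (1 ≤ r') × (r' ≤ r ∸ 1) × (((2 * r' ∸ 1) C r') ≤ m')
  × (∀ j → 1 ≤ j → j ≤ r ∸ 1 → ((2 * j ∸ 1) C j) ≤ m' → j ≤ r')

-- RExpansion r m E : E is the r-expansion of m, as the list of pairs
-- (r_i , a_i), i = 1..s, so that m = Σ_i (a_i C r_i).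
data RExpansion : ℕ → ℕ → List (ℕ × ℕ) → Set where
  stop : ∀ {r m a} → IsLargestA r m a → m ∸ (a C r) ≡ 0 →
         RExpansion r m ((r , a) ∷ [])
  step : ∀ {r m a r' E} → IsLargestA r m a → ¬ (m ∸ (a C r) ≡ 0) →
         IsLargestR r (m ∸ (a C r)) r' → RExpansion r' (m ∸ (a C r)) E →
         RExpansion r m ((r , a) ∷ E)

{-# OPTIONS --safe #-}
module Submission where

-- Every term satisfies C(2rᵢ-1, rᵢ) ≤ (current remainder), so maximality of aᵢ gives
-- aᵢ ≥ 2rᵢ - 1, which is (3) and aᵢ ≥ 1. The rᵢ decrease by construction. For
-- aᵢ₊₁ < aᵢ it suffices that the remainder m′ = m - C(aᵢ, rᵢ) is below C(aᵢ, rᵢ₊₁),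
-- since C(aᵢ₊₁, rᵢ₊₁) ≤ m′. The expansion exists by well-founded recursion on r:
-- the greatest a and r′ are found by bounded search, and for r = 1 the greatest a is
-- m itself, so the expansion stops there.

open import Defs
open import Data.Nat using (ℕ; zero; suc; _+_; _*_; _∸_; _≤_; _<_; _>_; z≤n; s≤s; s≤s⁻¹; _≤?_; _≟_; ⌊_/2⌋; ⌈_/2⌉)
open import Data.Nat.Properties
open import Data.Nat.Combinatorics using (_C_; nCk+nC[k+1]≡[n+1]C[k+1]; nCk≡nC[n∸k]; nC1≡n)
open import Data.Nat.Induction using (<-wellFounded)
open import Data.Product using (_×_; _,_; proj₁; proj₂; ∃; uncurry)
open import Data.Sum using (inj₁; inj₂)
open import Data.List using (map; head; last)
open import Data.List.Relation.Unary.All as All using (All; []; _∷_)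
open import Data.List.Relation.Unary.Linked as Linked using (Linked; [-]; _∷_)
open import Data.List.Relation.Unary.Linked.Properties as Linkedₚ using ()
open import Data.Maybe as Maybe using (just)
open import Data.Maybe.Relation.Unary.All as MaybeAll using (drop-just)
open import Data.List.Properties using (last-map)
open import Data.List.Relation.Unary.All.Properties using (last⁺)
open import Data.Empty using (⊥-elim)
open import Function using (_on_; _∘_)
open import Induction.WellFounded using (Acc; acc)
open import Relation.Nullary using (yes; no)
open import Relation.Nullary.Decidable using (_×-dec_)
open import Relation.Unary using (Pred; Decidable)
open import Relation.Binary.Construct.Intersection using (_∩_)
open import Relation.Binary.PropositionalEquality using (_≡_; refl; sym; trans; cong; subst; module ≡-Reasoning)

2*suc[n]∸1≡n+suc[n] : ∀ n → 2 * suc n ∸ 1 ≡ n + suc n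
2*suc[n]∸1≡n+suc[n] n = cong (n +_) (+-identityʳ (suc n))

n≤⌈2*n∸1/2⌉ : ∀ n → n ≤ ⌈ 2 * n ∸ 1 /2⌉
n≤⌈2*n∸1/2⌉ zero    = z≤n
n≤⌈2*n∸1/2⌉ (suc n) = ≤-reflexive (trans (n≡⌊n+n/2⌋ (suc n))
  (cong (λ k → ⌊ suc k /2⌋) (sym (2*suc[n]∸1≡n+suc[n] n))))

2*m∸1≤n⇒m≤⌈n/2⌉ : ∀ {m n} → 2 * m ∸ 1 ≤ n → m ≤ ⌈ n /2⌉
2*m∸1≤n⇒m≤⌈n/2⌉ {m} le = ≤-trans (n≤⌈2*n∸1/2⌉ m) (⌈n/2⌉-mono le)

nCk≤[n+1]Ck : ∀ n k → n C k ≤ suc n C k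
nCk≤[n+1]Ck n zero    = ≤-refl
nCk≤[n+1]Ck n (suc k) = subst (n C suc k ≤_) (nCk+nC[k+1]≡[n+1]C[k+1] n k) (m≤n+m _ _)

C-monoˡ-≤ : ∀ k {n n′} → n ≤ n′ → n C k ≤ n′ C k
C-monoˡ-≤ k {n′ = zero}   z≤n = ≤-refl
C-monoˡ-≤ k {n′ = suc n′} n≤1+n′ with m≤n⇒m<n∨m≡n n≤1+n′
... | inj₂ refl       = ≤-refl
... | inj₁ (s≤s n≤n′) = ≤-trans (C-monoˡ-≤ k n≤n′) (nCk≤[n+1]Ck n′ k)

C-cancelʳ-< : ∀ k {n n′} → n C k < n′ C k → n < n′
C-cancelʳ-< k {n} {n′} lt with n′ ≤? n
... | yes n′≤n = ⊥-elim (<⇒≱ lt (C-monoˡ-≤ k n′≤n))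
... | no  n′≰n = ≰⇒> n′≰n

n∸[1+k]≤nC[1+k] : ∀ n k → n ∸ suc k ≤ n C suc k
n∸[1+k]≤nC[1+k] zero    k       = z≤n
n∸[1+k]≤nC[1+k] (suc n) zero    = subst (n ≤_) (sym (nC1≡n (suc n))) (n≤1+n n)
n∸[1+k]≤nC[1+k] (suc n) (suc k) = subst (n ∸ suc k ≤_) (nCk+nC[k+1]≡[n+1]C[k+1] n (suc k))
  (≤-trans (n∸[1+k]≤nC[1+k] n k) (m≤m+n _ _))

[n+1+n]C[n+1]≡[n+1+n]Cn : ∀ n → (n + suc n) C suc n ≡ (n + suc n) C n
[n+1+n]C[n+1]≡[n+1+n]Cn n =
  trans (nCk≡nC[n∸k] (m≤n+m (suc n) n)) (cong ((n + suc n) C_) (m+n∸n≡m n (suc n)))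

Greatest : Pred ℕ _ → ℕ → Set
Greatest P a = P a × (∀ j → P j → j ≤ a)

greatest : ∀ {P} → Decidable P → ∀ n → (∀ j → P j → j ≤ n) → ∀ {j} → P j → ∃ (Greatest P)
greatest P? n bound pj with P? n
... | yes pn = n , pn , bound
greatest {P} P? zero bound pj | no ¬p0 = ⊥-elim (¬p0 (subst P (n≤0⇒n≡0 (bound _ pj)) pj))
greatest {P} P? (suc n) bound pj | no ¬pn = greatest P? n bound′ pj
  where
  bound′ : ∀ j → P j → j ≤ n
  bound′ j pj = s≤s⁻¹ (≤∧≢⇒< (bound j pj) (λ { refl → ¬pn pj }))

largestA-exists : ∀ k m → ∃ (IsLargestA (suc k) m)
largestA-exists k m = greatest (λ j → j C suc k ≤? m) (suc k + m) bound {0} z≤n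
  where
  bound : ∀ j → j C suc k ≤ m → j ≤ suc k + m
  bound j le = ≤-trans (m≤n+m∸n j (suc k)) (+-monoʳ-≤ (suc k) (≤-trans (n∸[1+k]≤nC[1+k] j k) le))

largestR-exists : ∀ k m′ → 1 ≤ m′ → ∃ (IsLargestR (2 + k) m′)
largestR-exists k m′ 1≤m′ with greatest (λ j → 1 ≤? j ×-dec j ≤? suc k ×-dec (2 * j ∸ 1) C j ≤? m′)
                               (suc k) (λ _ → proj₁ ∘ proj₂) (≤-refl , s≤s z≤n , 1≤m′)
... | r′ , (1≤r′ , r′≤k , bin≤m′) , max = r′ , 1≤r′ , r′≤k , bin≤m′ , λ j 1≤j j≤k le → max j (1≤j , j≤k , le)

IsLargestA-1⇒exact : ∀ {m a} → IsLargestA 1 m a → m ∸ a C 1 ≡ 0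
IsLargestA-1⇒exact {m} {a} (aC1≤m , max) = begin
  m ∸ a C 1 ≡⟨ cong (m ∸_) (trans (nC1≡n a) a≡m) ⟩
  m ∸ m     ≡⟨ n∸n≡0 m ⟩
  0         ∎
  where
  open ≡-Reasoning
  a≡m : a ≡ m
  a≡m = ≤-antisym (subst (_≤ m) (nC1≡n a) aC1≤m) (max m (≤-reflexive (nC1≡n m)))

expansion-exists : ∀ r m → Acc _<_ r → 1 ≤ r → ∃ (RExpansion r m)
expansion-exists (suc k) m _ _ with largestA-exists k m
... | a , la with m ∸ a C suc k ≟ 0
... | yes exact = _ , stop la exact
expansion-exists 1 m _ _ | a , la | no inexact = ⊥-elim (inexact (IsLargestA-1⇒exact la))
expansion-exists (suc (suc k)) m (acc rec) _ | a , la | no inexact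
  with largestR-exists k (m ∸ a C suc (suc k)) (n≢0⇒n>0 inexact)
... | r′ , lr@(1≤r′ , r′≤k+1 , _) =
  _ , step la inexact lr (proj₂ (expansion-exists r′ _ (rec (s≤s r′≤k+1)) 1≤r′))

largestA-remainder-< : ∀ {k m a} → IsLargestA (suc k) m a → m ∸ a C suc k < a C k
largestA-remainder-< {k} {m} {a} (aC[1+k]≤m , max) = begin-strict
  m ∸ a C suc k                           <⟨ ∸-monoˡ-< m<[1+a]C[1+k] aC[1+k]≤m ⟩
  suc a C suc k ∸ a C suc k               ≡⟨ cong (_∸ a C suc k) (sym (nCk+nC[k+1]≡[n+1]C[k+1] a k)) ⟩
  a C k + a C suc k ∸ a C suc k           ≡⟨ m+n∸n≡m (a C k) (a C suc k) ⟩
  a C k                                   ∎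
  where
  open ≤-Reasoning
  m<[1+a]C[1+k] : m < suc a C suc k
  m<[1+a]C[1+k] = ≰⇒> (λ le → 1+n≰n (max (suc a) le))

-- If r′ = r - 1 this is the maximality of a together with Pascal's rule; otherwise
-- the maximality of r′ gives m′ < C(2r′+1, r′+1) = C(2r′+1, r′), and 2r′+1 ≤ 2r-1 ≤ a.
remainder-<-next-C : ∀ {k m a r′} → 2 * suc k ∸ 1 ≤ a → IsLargestA (suc k) m a →
                     IsLargestR (suc k) (m ∸ a C suc k) r′ → m ∸ a C suc k < a C r′
remainder-<-next-C {k} {m} {a} {r′} low la (_ , r′≤k , _ , max) with m≤n⇒m<n∨m≡n r′≤k
... | inj₂ refl  = largestA-remainder-< la
... | inj₁ r′<k = begin-strict
  m ∸ a C suc k                <⟨ m′<middle ⟩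
  (2 * suc r′ ∸ 1) C suc r′    ≡⟨ cong (_C suc r′) (2*suc[n]∸1≡n+suc[n] r′) ⟩
  (r′ + suc r′) C suc r′       ≡⟨ [n+1+n]C[n+1]≡[n+1+n]Cn r′ ⟩
  (r′ + suc r′) C r′           ≤⟨ C-monoˡ-≤ r′ middle≤a ⟩
  a C r′                       ∎
  where
  open ≤-Reasoning
  m′<middle : m ∸ a C suc k < (2 * suc r′ ∸ 1) C suc r′
  m′<middle = ≰⇒> (λ le → 1+n≰n (max (suc r′) (s≤s z≤n) r′<k le))
  middle≤a : r′ + suc r′ ≤ a
  middle≤a = ≤-trans (+-mono-≤ (<⇒≤ r′<k) (s≤s (<⇒≤ r′<k)))
                     (subst (_≤ a) (2*suc[n]∸1≡n+suc[n] k) low)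

consecutive-decreasing : ∀ {r m a r′ a′} → (2 * r ∸ 1) C r ≤ m → IsLargestA r m a →
                         IsLargestR r (m ∸ a C r) r′ → IsLargestA r′ (m ∸ a C r) a′ →
                         r > r′ × a > a′
consecutive-decreasing {zero} _ _ (s≤s _ , () , _) _
consecutive-decreasing {suc k} {r′ = r′} middle≤m la@(_ , max) lr@(_ , r′≤k , _) (a′C≤m′ , _) =
  s≤s r′≤k , C-cancelʳ-< r′ (≤-<-trans a′C≤m′ (remainder-<-next-C (max _ middle≤m) la lr))

expansion-linked : ∀ {r m E} → (2 * r ∸ 1) C r ≤ m → RExpansion r m E →
                   Linked ((_>_ on proj₁) ∩ (_>_ on proj₂)) E
expansion-linked _ (stop _ _) = [-]
expansion-linked middle≤m (step la _ lr@(_ , _ , middle′≤m′ , _) ex@(stop la′ _)) =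
  consecutive-decreasing middle≤m la lr la′ ∷ expansion-linked middle′≤m′ ex
expansion-linked middle≤m (step la _ lr@(_ , _ , middle′≤m′ , _) ex@(step la′ _ _ _)) =
  consecutive-decreasing middle≤m la lr la′ ∷ expansion-linked middle′≤m′ ex

expansion-terms : ∀ {r m E} → 1 ≤ r → (2 * r ∸ 1) C r ≤ m → RExpansion r m E →
                  All (uncurry λ rᵢ aᵢ → 1 ≤ rᵢ × 2 * rᵢ ∸ 1 ≤ aᵢ) E
expansion-terms 1≤r middle≤m (stop (_ , max) _) = (1≤r , max _ middle≤m) ∷ []
expansion-terms 1≤r middle≤m (step (_ , max) _ (1≤r′ , _ , middle′≤m′ , _) ex) =
  (1≤r , max _ middle≤m) ∷ expansion-terms 1≤r′ middle′≤m′ ex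

expansion-head : ∀ {r m E} → RExpansion r m E → head (map proj₁ E) ≡ just r
expansion-head (stop _ _)     = refl
expansion-head (step _ _ _ _) = refl

expansion-last : ∀ {r m E} → RExpansion r m E → ∃ λ p → last E ≡ just p
expansion-last (stop _ _) = _ , refl
expansion-last (step _ _ _ (stop _ _))       = _ , refl
expansion-last (step _ _ _ ex@(step _ _ _ _)) = expansion-last ex

lemma5p2 : ∀ (m r : ℕ) → 1 ≤ m → 1 ≤ r → ((2 * r ∸ 1) C r) ≤ m →
    (∃ λ E → RExpansion r m E)
    × (∀ E → RExpansion r m E →
        -- (1) r = r_1 > r_2 > ... > r_s ≥ 1
        ((head (map proj₁ E) ≡ just r)
          × Linked _>_ (map proj₁ E)
          × (∃ λ rs → (last (map proj₁ E) ≡ just rs) × (1 ≤ rs)))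
        -- (2) a_{r_1} > a_{r_2} > ... > a_{r_s} ≥ 1
        × (Linked _>_ (map proj₂ E)
          × (∃ λ as → (last (map proj₂ E) ≡ just as) × (1 ≤ as)))
        -- (3) r_i ≤ ⌈ a_{r_i} / 2 ⌉ for all i
        × All (λ p → proj₁ p ≤ ⌈ proj₂ p /2⌉) E)
lemma5p2 m r _ 1≤r middle≤m = expansion-exists r m (<-wellFounded r) 1≤r , λ E ex →
  let terms               = expansion-terms 1≤r middle≤m ex
      r-linked , a-linked = Linked.unzip (expansion-linked middle≤m ex)
      (rₛ , aₛ) , last≡   = expansion-last ex
      1≤rₛ , middleₛ≤aₛ  = drop-just (subst (MaybeAll.All _) last≡ (last⁺ terms))
  in (expansion-head ex , Linkedₚ.map⁺ r-linked ,
      rₛ , trans (last-map proj₁ E) (cong (Maybe.map proj₁) last≡) , 1≤rₛ)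
   , (Linkedₚ.map⁺ a-linked ,
      aₛ , trans (last-map proj₂ E) (cong (Maybe.map proj₂) last≡) ,
      ≤-trans 1≤rₛ (≤-trans (2*m∸1≤n⇒m≤⌈n/2⌉ middleₛ≤aₛ) (⌈n/2⌉≤n aₛ)))
   , All.map (2*m∸1≤n⇒m≤⌈n/2⌉ ∘ proj₂) terms
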